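{- For every integer $m\ge 2$, $\mathrm{disc}(4m+2,4)=2$.
   Context: $S_n$ denotes the set of permutations $\pi=(\pi_1,\ldots,\pi_n)$ of $1,\ldots,n$, with indices taken cyclically: $\pi_{n+i}=\pi_i$. For $\pi\in S_n$ and $1\le k<n$ let $s_i=\sum_{j=0}^{k-1}\pi_{i+j}$ for $i=1,\ldots,n$. Define $\mathrm{disc}(\pi,k)=\max\{|s_i-\frac{k(n+1)}{2}|: 1\le i\le n\}$ and $\mathrm{disc}(n,k)=\min\{\mathrm{disc}(\pi,k):\pi\in S_n\}$. -}

module Defs where

open import Data.Nat using (ℕ; zero; suc; _+_; _*_; _⊔_; _≤_; NonZero)
open import Data.Nat.DivMod using (_%_)
open import Data.Integer as ℤ using (ℤ; +_; ∣_∣; _-_)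
open import Data.Fin using (Fin; toℕ; fromℕ<)
open import Data.Nat.DivMod using (m%n<n)
open import Data.List using (List; map; foldr; upTo)
open import Data.Nat.ListAction using (sum)
open import Function.Bundles using (_↔_; Inverse)
open import Data.Product using (Σ; _×_; _,_)
open import Data.Unit using (⊤)
open import Relation.Binary.PropositionalEquality using (_≡_)

-- A permutation of 1..n: a bijection of Fin n; π_i (1-based) is toℕ (π (i-1)) + 1.
Perm : ℕ → Set
Perm n = Fin n ↔ Fin n

-- π_{i} with 0-based cyclic index i (i.e. π_{i+1} in the paper), valued in 1..n
entry : ∀ {n} .{{_ : NonZero n}} → Perm n → ℕ → ℕ
entry {n} π i = suc (toℕ (Inverse.to π (fromℕ< (m%n<n i n))))

-- s_{i+1} = Σ_{j=0}^{k-1} π_{i+1+j}   (0-based i)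
windowSum : ∀ {n} .{{_ : NonZero n}} → Perm n → ℕ → ℕ → ℕ
windowSum π k i = sum (map (λ j → entry π (i + j)) (upTo k))

-- 2·|s_i - k(n+1)/2| = |2 s_i - k(n+1)|   (doubling avoids half-integers)
twiceDev : ∀ {n} .{{_ : NonZero n}} → Perm n → ℕ → ℕ → ℕ
twiceDev {n} π k i = ∣ + (2 * windowSum π k i) - + (k * (n + 1)) ∣

twiceDisc : ∀ {n} .{{_ : NonZero n}} → Perm n → ℕ → ℕ
twiceDisc {n} π k = foldr _⊔_ 0 (map (twiceDev π k) (upTo n))

-- disc(n,k) = d  (given as the doubled value 2d): the minimum over π is attained and equals d
-- (for n = 0 there is nothing to state; the statement only uses n ≥ 10)
DiscEq : (n k : ℕ) → ℕ → Set
DiscEq zero k twoD = ⊤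
DiscEq n@(suc _) k twoD = Σ (Perm n) (λ π → twiceDisc π k ≡ twoD) × ((π : Perm n) → twoD ≤ twiceDisc π k)

module Submission where

-- If all W_i were within 1 of 2(N + 1), then π_{i+4} - π_i = W_{i+1} - W_i
-- would make terms 4k apart differ by at most 2k (Band.walk), and since π_{i+4} ≠ π_i consecutive
-- windows differ, so π_x - π_{x+4} and π_{x+6} - π_{x+2} are never both 2 (Band.zigzag).  As
-- N = 2(2m + 1), positions of equal parity are joined by walks of at most m steps; so N and 1 lie in
-- different parity classes and 2m + 2, 2m + 3 sit exactly 4m and 2 places after N (Anchored.pinned).
-- Two zigzags at the position of N plus walks of m - 2 steps then give 2N ≤ 2N - 1.
--
-- Positions 2k, 2k + 1 carry z + 1 and N - z with z = zig (k mod
-- 2m + 1), zig fixing the even and reflecting the odd numbers of 0..2m.  Windows at even positions sum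
-- to exactly 2(N + 1); at odd positions they deviate by a step of zig, which is at most 2.

open import Defs
open import Data.Nat
open import Data.Nat.Properties
open import Data.Nat.DivMod
  using (_%_; _/_; m%n<n; m≡m%n+[m/n]*n; m<n⇒m%n≡m; [m+n]%n≡m%n; [m+kn]%n≡m%n; n%n≡0; %-distribˡ-+; m%n%n≡m%n; m≤n⇒[n∸m]%m≡n%m)
open import Data.Nat.Tactic.RingSolver using (solve-∀)
import Data.Integer as ℤ
open import Data.Integer.Properties using (m-n≡m⊖n; ∣⊖∣-≤; ∣m⊖n∣≡∣n⊖m∣)
open import Data.Fin using (Fin; toℕ; fromℕ<)
open import Data.Fin.Properties using (toℕ-injective; toℕ-fromℕ<; fromℕ<-cong; fromℕ<-toℕ; toℕ<n)
open import Data.List using ([]; _∷_; map; foldr; upTo)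
open import Data.List.Membership.Propositional using (_∈_)
open import Data.List.Membership.Propositional.Properties using (∈-upTo⁺)
open import Data.List.Relation.Unary.Any using (here; there)
open import Function using (_∘_)
open import Function.Bundles using (Inverse; mk↔ₛ′)
open import Data.Product using (Σ; ∃; _×_; _,_; proj₁; proj₂)
open import Data.Sum as Sum using (_⊎_; inj₁; inj₂)
open import Data.Empty using (⊥; ⊥-elim)
open import Data.Unit using (tt)
open import Relation.Nullary using (¬_; yes; no; contradiction)
open import Relation.Binary.PropositionalEquality

-- Near d a b : the natural numbers a and b are at distance at most d.  All estimates of the
-- proof are phrased with this relation, which avoids truncated subtraction.
Near : ℕ → ℕ → ℕ → Set
Near d a b = a ≤ b + d × b ≤ a + d

near-refl : ∀ {d} a → Near d a a
near-refl {d} a = m≤m+n a d , m≤m+n a d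

near-sym : ∀ {d a b} → Near d a b → Near d b a
near-sym (p , q) = q , p

near-weaken : ∀ {d e a b} → d ≤ e → Near d a b → Near e a b
near-weaken d≤e (p , q) = ≤-trans p (+-monoʳ-≤ _ d≤e) , ≤-trans q (+-monoʳ-≤ _ d≤e)

near-trans : ∀ {d e a b c} → Near d a b → Near e b c → Near (d + e) a c
near-trans {d} {e} {a} {b} {c} (ab , ba) (bc , cb) =
    ≤-trans ab (≤-trans (+-monoˡ-≤ d bc) (≤-reflexive (trans (+-assoc c e d) (cong (c +_) (+-comm e d)))))
  , ≤-trans cb (≤-trans (+-monoˡ-≤ e ba) (≤-reflexive (+-assoc a d e)))

near-+2 : ∀ x → Near 2 x (2 + x)
near-+2 x = ≤-trans (m≤n+m x 2) (m≤m+n (2 + x) 2) , ≤-reflexive (+-comm 2 x)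

near-∸1 : ∀ x → Near 2 x (x ∸ 1)
near-∸1 x = ≤-trans (m≤n+m∸n x 1) (≤-trans (≤-reflexive (+-comm 1 (x ∸ 1))) (+-monoʳ-≤ (x ∸ 1) (s≤s z≤n)))
          , ≤-trans (m∸n≤m x 1) (m≤m+n x 2)

near-double : ∀ {d a b} → Near d a b → Near (2 * d) (2 * a) (2 * b)
near-double {d} {a} {b} (ab , ba) = ≤-trans (*-monoʳ-≤ 2 ab) (≤-reflexive (*-distribˡ-+ 2 b d))
                                  , ≤-trans (*-monoʳ-≤ 2 ba) (≤-reflexive (*-distribˡ-+ 2 a d))

trade : ∀ {a b u v d} → a + u ≡ b + v → Near d u v → Near d a b
trade {a} {b} {u} {v} {d} e (u≤ , v≤) =
    +-cancelʳ-≤ u a (b + d) (begin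
      a + u     ≡⟨ e ⟩
      b + v     ≤⟨ +-monoʳ-≤ b v≤ ⟩
      b + (u + d) ≡⟨ swap b u d ⟩
      b + d + u ∎)
  , +-cancelʳ-≤ v b (a + d) (begin
      b + v     ≡⟨ e ⟨
      a + u     ≤⟨ +-monoʳ-≤ a u≤ ⟩
      a + (v + d) ≡⟨ swap a v d ⟩
      a + d + v ∎)
  where
  open ≤-Reasoning
  swap : ∀ b u d → b + (u + d) ≡ b + d + u
  swap = solve-∀

below-pair : ∀ {c x y} → c ≤ x + 1 → x < y → c + c ≤ x + y + 1
below-pair {c} {x} {y} c≤x+1 x<y =
  ≤-trans (+-mono-≤ c≤x+1 (≤-trans c≤x+1 (≤-trans (≤-reflexive (+-comm x 1)) x<y))) (≤-reflexive (swap x y))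
  where swap : ∀ x y → x + 1 + y ≡ x + y + 1
        swap = solve-∀

distinct-sum : ∀ {u v c} → Near 1 u c → Near 1 v c → u ≢ v → c + c ≤ u + v + 1
distinct-sum {u} {v} {c} (_ , c≤u+1) (_ , c≤v+1) u≢v with ≤-total u v
... | inj₁ u≤v = below-pair c≤u+1 (≤∧≢⇒< u≤v u≢v)
... | inj₂ v≤u = subst (c + c ≤_) (cong (_+ 1) (+-comm v u)) (below-pair c≤v+1 (≤∧≢⇒< v≤u (u≢v ∘ sym)))

∣+-+∣≡∣-∣ : ∀ a b → ℤ.∣ ℤ.+ a ℤ.- ℤ.+ b ∣ ≡ ∣ a - b ∣
∣+-+∣≡∣-∣ a b with ≤-total a b
... | inj₁ a≤b = trans (cong ℤ.∣_∣ (m-n≡m⊖n a b)) (trans (∣⊖∣-≤ a≤b) (sym (m≤n⇒∣m-n∣≡n∸m a≤b)))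
... | inj₂ b≤a = trans (cong ℤ.∣_∣ (m-n≡m⊖n a b))
                   (trans (∣m⊖n∣≡∣n⊖m∣ a b) (trans (∣⊖∣-≤ b≤a) (sym (trans (∣-∣-comm a b) (m≤n⇒∣m-n∣≡n∸m b≤a)))))

dist⇒near : ∀ {d} a b → ℤ.∣ ℤ.+ a ℤ.- ℤ.+ b ∣ ≤ d → Near d a b
dist⇒near a b h = ≤-trans (m≤n+∣m-n∣ a b) (+-monoʳ-≤ b h′) , ≤-trans (m≤n+∣n-m∣ b a) (+-monoʳ-≤ a h′)
  where h′ = subst (_≤ _) (∣+-+∣≡∣-∣ a b) h

near⇒dist : ∀ {d} a b → Near d a b → ℤ.∣ ℤ.+ a ℤ.- ℤ.+ b ∣ ≤ d
near⇒dist a b (ab , ba) with ≤-total a b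
... | inj₁ a≤b = subst (_≤ _) (sym (trans (∣+-+∣≡∣-∣ a b) (m≤n⇒∣m-n∣≡n∸m a≤b))) (m≤n+o⇒m∸n≤o b a ba)
... | inj₂ b≤a = subst (_≤ _) (sym (trans (∣+-+∣≡∣-∣ a b) (trans (∣-∣-comm a b) (m≤n⇒∣m-n∣≡n∸m b≤a)))) (m≤n+o⇒m∸n≤o a b ab)

near-halve : ∀ {a b} → Near 3 (2 * a) (2 * b) → Near 1 a b
near-halve {a} {b} (ab , ba) = half ab , half ba
  where
  half : ∀ {x y} → 2 * x ≤ 2 * y + 3 → x ≤ y + 1
  half {x} {y} le = s≤s⁻¹ (subst (x <_) (+-suc y 1) (*-cancelˡ-< 2 x (y + 2)
                      (≤-trans (s≤s le) (≤-reflexive (twice y)))))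
    where twice : ∀ y → suc (2 * y + 3) ≡ 2 * (y + 2)
          twice = solve-∀

data Parity-view : ℕ → Set where
  even : ∀ k → Parity-view (k * 2)
  odd  : ∀ k → Parity-view (1 + k * 2)

parity-view : ∀ n → Parity-view n
parity-view zero = even 0
parity-view (suc zero) = odd 0
parity-view (suc (suc n)) with parity-view n
... | even k = even (suc k)
... | odd k  = odd (suc k)

parity-view-even : ∀ k → parity-view (k * 2) ≡ even k
parity-view-even zero = refl
parity-view-even (suc k) rewrite parity-view-even k = refl

parity-view-odd : ∀ k → parity-view (1 + k * 2) ≡ odd k
parity-view-odd zero = refl
parity-view-odd (suc k) rewrite parity-view-odd k = refl

half-≤ : ∀ {k m} → k * 2 < 1 + m * 2 → k ≤ m
half-≤ {k} {m} lt = *-cancelʳ-≤ k m 2 (s≤s⁻¹ lt)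

half-< : ∀ {k m} → 1 + k * 2 < 1 + m * 2 → k < m
half-< {k} {m} lt = *-cancelʳ-< 2 k m (s≤s⁻¹ lt)

pair-sum : ∀ {a b x y : ℕ} → (a ≡ x ⊎ a ≡ y) → (b ≡ x ⊎ b ≡ y) → a ≢ b → x + y ≡ a + b
pair-sum (inj₁ refl) (inj₁ refl) a≢b = ⊥-elim (a≢b refl)
pair-sum (inj₁ refl) (inj₂ refl) a≢b = refl
pair-sum {a} {b} (inj₂ refl) (inj₁ refl) a≢b = +-comm b a
pair-sum (inj₂ refl) (inj₂ refl) a≢b = ⊥-elim (a≢b refl)

mod-absorb : ∀ {n} .{{_ : NonZero n}} c i → (c + i) % n ≡ (c + i % n) % n
mod-absorb {n} c i = trans (%-distribˡ-+ c i n) (trans (cong (λ r → (c % n + r) % n) (sym (m%n%n≡m%n i n)))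
                       (sym (%-distribˡ-+ c (i % n) n)))

shift-mod : ∀ {n} .{{_ : NonZero n}} a i → 0 < a → a < n → (a + i) % n ≢ i % n
shift-mod {n} (suc a) i _ a<n e with suc a + i % n <? n
... | yes small = m≢1+n+m (i % n) (begin
    i % n               ≡⟨ e ⟨
    (suc a + i) % n     ≡⟨ mod-absorb (suc a) i ⟩
    (suc a + i % n) % n ≡⟨ m<n⇒m%n≡m small ⟩
    suc a + i % n       ∎)
  where open ≡-Reasoning
... | no large = <⇒≢ a<n (+-cancelʳ-≡ (i % n) (suc a) n (begin
    suc a + i % n             ≡⟨ m∸n+n≡m n≤ ⟨
    suc a + i % n ∸ n + n     ≡⟨ cong (_+ n) wrapped ⟩
    i % n + n                 ≡⟨ +-comm (i % n) n ⟩
    n + i % n                 ∎))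
  where
  open ≡-Reasoning
  n≤ : n ≤ suc a + i % n
  n≤ = ≮⇒≥ large
  below : suc a + i % n ∸ n < n
  below = ≤-<-trans (∸-monoˡ-≤ n (+-monoˡ-≤ (i % n) (<⇒≤ a<n))) (subst (_< n) (sym (m+n∸m≡n n (i % n))) (m%n<n i n))
  wrapped : suc a + i % n ∸ n ≡ i % n
  wrapped = begin
    suc a + i % n ∸ n            ≡⟨ m<n⇒m%n≡m below ⟨
    (suc a + i % n ∸ n) % n      ≡⟨ m≤n⇒[n∸m]%m≡n%m n≤ ⟩
    (suc a + i % n) % n          ≡⟨ mod-absorb (suc a) i ⟨
    (suc a + i) % n              ≡⟨ e ⟩
    i % n                        ∎

max-upper : ∀ (g : ℕ → ℕ) {xs i} → i ∈ xs → g i ≤ foldr _⊔_ 0 (map g xs)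
max-upper g (here refl) = m≤m⊔n _ _
max-upper g {x ∷ _} (there i∈xs) = ≤-trans (max-upper g i∈xs) (m≤n⊔m (g x) _)

max-least : ∀ (g : ℕ → ℕ) xs {c} → (∀ {i} → i ∈ xs → g i ≤ c) → foldr _⊔_ 0 (map g xs) ≤ c
max-least g [] bound = z≤n
max-least g (x ∷ xs) bound = ⊔-lub (bound (here refl)) (max-least g xs (λ i∈xs → bound (there i∈xs)))

window : (ℕ → ℕ) → ℕ → ℕ
window f i = f i + f (1 + i) + f (2 + i) + f (3 + i)

window-shift : ∀ (f : ℕ → ℕ) i → f (4 + i) + window f i ≡ f i + window f (1 + i)
window-shift f i = exchange (f i) (f (1 + i)) (f (2 + i)) (f (3 + i)) (f (4 + i))
  where exchange : ∀ a b c d e → e + (a + b + c + d) ≡ a + (b + c + d + e)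
        exchange = solve-∀

module Band (f : ℕ → ℕ) (c : ℕ) (band : ∀ i → Near 1 (window f i) c) where

  step : ∀ i → Near 2 (f i) (f (4 + i))
  step i = near-sym (trade (window-shift f i) (near-trans (band i) (near-sym (band (1 + i)))))

  walk : ∀ i k → Near (k * 2) (f i) (f (k * 4 + i))
  walk i zero    = near-refl (f i)
  walk i (suc k) = near-weaken (≤-reflexive (+-comm (k * 2) 2)) (near-trans (walk i k) (step (k * 4 + i)))

  module _ (distinct4 : ∀ i → f (4 + i) ≢ f i) where

    windows-distinct : ∀ i → window f (1 + i) ≢ window f i
    windows-distinct i e = distinct4 i (+-cancelʳ-≡ (window f i) (f (4 + i)) (f i)
      (trans (window-shift f i) (cong (f i +_) e)))

    zigzag : ∀ x → f x + f (6 + x) ≤ f (2 + x) + f (4 + x) + 3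
    zigzag x = +-cancelʳ-≤ (c + c) (f x + f (6 + x)) (f (2 + x) + f (4 + x) + 3) (begin
      f x + f (6 + x) + (c + c)                  ≤⟨ +-monoʳ-≤ (f x + f (6 + x)) middle≥ ⟩
      f x + f (6 + x) + (W 1 + W 2 + 1)          ≡⟨ exchange ⟩
      f (2 + x) + f (4 + x) + (W 0 + W 3) + 1    ≤⟨ +-monoˡ-≤ 1 (+-monoʳ-≤ (f (2 + x) + f (4 + x))
                                                       (+-mono-≤ (proj₁ (band x)) (proj₁ (band (3 + x))))) ⟩
      f (2 + x) + f (4 + x) + (c + 1 + (c + 1)) + 1 ≡⟨ tidy (f (2 + x) + f (4 + x)) c ⟩
      f (2 + x) + f (4 + x) + 3 + (c + c)        ∎)
      where
      open ≤-Reasoning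
      W : ℕ → ℕ
      W j = window f (j + x)
      middle≥ : c + c ≤ W 1 + W 2 + 1
      middle≥ = distinct-sum (band (1 + x)) (band (2 + x)) (λ e → windows-distinct (1 + x) (sym e))
      exchange : f x + f (6 + x) + (W 1 + W 2 + 1) ≡ f (2 + x) + f (4 + x) + (W 0 + W 3) + 1
      exchange = begin-equality
        f x + f (6 + x) + (W 1 + W 2 + 1)          ≡⟨ regroup (f x) (f (6 + x)) (W 1) (W 2) ⟩
        (f x + W 1) + (f (6 + x) + W 2) + 1        ≡⟨ cong₂ (λ p q → p + q + 1) (sym (window-shift f x)) (window-shift f (2 + x)) ⟩
        (f (4 + x) + W 0) + (f (2 + x) + W 3) + 1  ≡⟨ regroup′ (f (4 + x)) (W 0) (f (2 + x)) (W 3) ⟩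
        f (2 + x) + f (4 + x) + (W 0 + W 3) + 1    ∎
        where
        regroup : ∀ a d u v → a + d + (u + v + 1) ≡ (a + u) + (d + v) + 1
        regroup = solve-∀
        regroup′ : ∀ a u b v → (a + u) + (b + v) + 1 ≡ b + a + (u + v) + 1
        regroup′ = solve-∀
      tidy : ∀ s c → s + (c + 1 + (c + 1)) + 1 ≡ s + 3 + (c + c)
      tidy = solve-∀

    zigzag₂ : ∀ x → f x + f (10 + x) ≤ f (2 + x) + f (8 + x) + 6
    zigzag₂ x = +-cancelʳ-≤ (f (4 + x) + f (6 + x)) (f x + f (10 + x)) (f (2 + x) + f (8 + x) + 6) (begin
      f x + f (10 + x) + (f (4 + x) + f (6 + x))                 ≡⟨ regroup (f x) (f (10 + x)) (f (4 + x)) (f (6 + x)) ⟩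
      (f x + f (6 + x)) + (f (4 + x) + f (10 + x))               ≤⟨ +-mono-≤ (zigzag x) (zigzag (4 + x)) ⟩
      (f (2 + x) + f (4 + x) + 3) + (f (6 + x) + f (8 + x) + 3) ≡⟨ regroup′ (f (2 + x)) (f (4 + x)) (f (6 + x)) (f (8 + x)) ⟩
      f (2 + x) + f (8 + x) + 6 + (f (4 + x) + f (6 + x))        ∎)
      where
      open ≤-Reasoning
      regroup : ∀ a g c d → a + g + (c + d) ≡ (a + d) + (c + g)
      regroup = solve-∀
      regroup′ : ∀ b c d e → (b + c + 3) + (d + e + 3) ≡ b + e + 6 + (c + d)
      regroup′ = solve-∀

module _ {n : ℕ} {{_ : NonZero n}} (π : Perm n) where
  open Inverse π using (to; from; strictlyInverseˡ; strictlyInverseʳ)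

  entry-mod : ∀ {i j} → i % n ≡ j % n → entry π i ≡ entry π j
  entry-mod {i} {j} i≡j = cong (λ x → suc (toℕ (to x))) (fromℕ<-cong _ _ i≡j (m%n<n i n) (m%n<n j n))

  entry-periodic : ∀ i k → entry π (i + k * n) ≡ entry π i
  entry-periodic i k = entry-mod ([m+kn]%n≡m%n i k n)

  entry-injective : ∀ {i j} → entry π i ≡ entry π j → i % n ≡ j % n
  entry-injective {i} {j} e = begin
    i % n                             ≡⟨ toℕ-fromℕ< (m%n<n i n) ⟨
    toℕ (fromℕ< (m%n<n i n))          ≡⟨ cong toℕ (to-injective (toℕ-injective (suc-injective e))) ⟩
    toℕ (fromℕ< (m%n<n j n))          ≡⟨ toℕ-fromℕ< (m%n<n j n) ⟩
    j % n                             ∎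
    where
    open ≡-Reasoning
    to-injective : ∀ {x y} → to x ≡ to y → x ≡ y
    to-injective {x} {y} e = trans (sym (strictlyInverseʳ x)) (trans (cong from e) (strictlyInverseʳ y))

  entry-onto : ∀ v → v < n → ∃ λ j → entry π j ≡ suc v
  entry-onto v v<n = j , cong suc (begin
    toℕ (to (fromℕ< (m%n<n j n))) ≡⟨ cong (λ x → toℕ (to x)) (fromℕ<-cong _ _ (m<n⇒m%n≡m (toℕ<n y)) _ (toℕ<n y)) ⟩
    toℕ (to (fromℕ< (toℕ<n y)))  ≡⟨ cong (λ x → toℕ (to x)) (fromℕ<-toℕ y (toℕ<n y)) ⟩
    toℕ (to y)                   ≡⟨ cong toℕ (strictlyInverseˡ (fromℕ< v<n)) ⟩
    toℕ (fromℕ< v<n)             ≡⟨ toℕ-fromℕ< v<n ⟩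
    v                            ∎)
    where
    open ≡-Reasoning
    y : Fin n
    y = from (fromℕ< v<n)
    j : ℕ
    j = toℕ y

  windowSum≡window : ∀ i → windowSum π 4 i ≡ window (entry π) i
  windowSum≡window i = begin
    f (i + 0) + (f (i + 1) + (f (i + 2) + (f (i + 3) + 0)))
      ≡⟨ cong₂ (λ a b → f a + (f b + (f (i + 2) + (f (i + 3) + 0)))) (+-identityʳ i) (+-comm i 1) ⟩
    f i + (f (1 + i) + (f (i + 2) + (f (i + 3) + 0)))
      ≡⟨ cong₂ (λ a b → f i + (f (1 + i) + (f a + (f b + 0)))) (+-comm i 2) (+-comm i 3) ⟩
    f i + (f (1 + i) + (f (2 + i) + (f (3 + i) + 0)))
      ≡⟨ regroup (f i) (f (1 + i)) (f (2 + i)) (f (3 + i)) ⟩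
    window f i ∎
    where
    open ≡-Reasoning
    f : ℕ → ℕ
    f = entry π
    regroup : ∀ a b c d → a + (b + (c + (d + 0))) ≡ a + b + c + d
    regroup = solve-∀

perm-from : ∀ {n} (σ τ : ℕ → ℕ) → (∀ {i} → i < n → σ i < n) → (∀ {v} → v < n → τ v < n) →
            (∀ {i} → i < n → τ (σ i) ≡ i) → (∀ {v} → v < n → σ (τ v) ≡ v) →
            Σ (Perm n) λ π → ∀ x → toℕ (Inverse.to π x) ≡ σ (toℕ x)
perm-from σ τ σ< τ< τσ στ = mk↔ₛ′ to from
    (λ y → toℕ-injective (trans (toℕ-fromℕ< _) (trans (cong σ (toℕ-fromℕ< _)) (στ (toℕ<n y)))))
    (λ x → toℕ-injective (trans (toℕ-fromℕ< _) (trans (cong τ (toℕ-fromℕ< _)) (τσ (toℕ<n x)))))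
  , λ x → toℕ-fromℕ< _
  where
  to from : Fin _ → Fin _
  to   x = fromℕ< (σ< (toℕ<n x))
  from y = fromℕ< (τ< (toℕ<n y))

entry-perm-from : ∀ {n} .{{_ : NonZero n}} (π : Perm n) (σ : ℕ → ℕ) →
                  (∀ x → toℕ (Inverse.to π x) ≡ σ (toℕ x)) → ∀ i → entry π i ≡ suc (σ (i % n))
entry-perm-from {n} π σ spec i = cong suc (trans (spec _) (cong σ (toℕ-fromℕ< (m%n<n i n))))

4m+2-nonZero : ∀ m → NonZero (4 * m + 2)
4m+2-nonZero m = >-nonZero (≤-trans (s≤s z≤n) (m≤n+m 2 (4 * m)))

module Rigid (m : ℕ) (f : ℕ → ℕ)
  (periodic  : ∀ i k → f (i + k * (4 * m + 2)) ≡ f i)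
  (distinct4 : ∀ i → f (4 + i) ≢ f i)
  (band      : ∀ i → Near 1 (window f i) (2 * (4 * m + 2 + 1)))
  where

  N : ℕ
  N = 4 * m + 2

  M : ℕ
  M = 1 + m * 2

  open Band f (2 * (N + 1)) band

  shifted : ∀ {a i} k → a ≡ i + k * N → f a ≡ f i
  shifted k refl = periodic _ k

  reduce : ∀ x t → ∃ λ s → s < M × f (t * 2 + x) ≡ f (s * 2 + x)
  reduce x t = t % M , m%n<n t M , shifted (t / M) (begin
    t * 2 + x                           ≡⟨ cong (λ u → u * 2 + x) (m≡m%n+[m/n]*n t M) ⟩
    (t % M + t / M * M) * 2 + x         ≡⟨ unfold (t % M) (t / M) x m ⟩
    t % M * 2 + x + t / M * N           ∎)
    where
    open ≡-Reasoning
    unfold : ∀ s r x m → (s + r * (1 + m * 2)) * 2 + x ≡ s * 2 + x + r * (4 * m + 2)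
    unfold = solve-∀

  -- Offsets 2s with s < M are reached by at most m steps of 4: forwards when s = 2k, and from
  -- x + 2s forwards to x + N when s = 2k + 1.  So values at even offsets differ by at most 2m ...
  reach-reduced : ∀ x s → s < M → Near (m * 2) (f x) (f (s * 2 + x))
  reach-reduced x s s<M with parity-view s
  ... | even k = near-weaken {k * 2} {m * 2} (*-monoˡ-≤ 2 (half-≤ {k} {m} s<M))
                   (subst (λ a → Near (k * 2) (f x) (f a)) (quadruple k x) (walk x k))
    where quadruple : ∀ k x → k * 4 + x ≡ k * 2 * 2 + x
          quadruple = solve-∀
  ... | odd k with m≤n⇒∃[o]m+o≡n (half-< {k} {m} s<M)
  ...   | o , k+1+o≡m = near-weaken {suc o * 2} {m * 2} (*-monoˡ-≤ 2 (subst (suc o ≤_) k+1+o≡m (s≤s (m≤n+m o k))))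
                          (near-sym (subst (λ v → Near (suc o * 2) (f ((1 + k * 2) * 2 + x)) v) back
                                      (walk ((1 + k * 2) * 2 + x) (suc o))))
    where
    around : ∀ k o x → suc o * 4 + ((1 + k * 2) * 2 + x) ≡ x + 1 * (4 * (suc k + o) + 2)
    around = solve-∀
    back : f (suc o * 4 + ((1 + k * 2) * 2 + x)) ≡ f x
    back = shifted {i = x} 1 (trans (around k o x) (cong (λ m → x + 1 * (4 * m + 2)) k+1+o≡m))

  reach : ∀ x t → Near (m * 2) (f x) (f (t * 2 + x))
  reach x t with reduce x t
  ... | s , s<M , e = subst (Near (m * 2) (f x)) (sym e) (reach-reduced x s s<M)

  coset-near : ∀ x s t → Near (m * 2) (f (s * 2 + x)) (f (t * 2 + x))
  coset-near x s t = subst (Near (m * 2) (f (s * 2 + x))) (shifted s (realign s t x m)) (reach (s * 2 + x) (t + s * (m * 2)))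
    where realign : ∀ s t x m → (t + s * (m * 2)) * 2 + (s * 2 + x) ≡ t * 2 + x + s * (4 * m + 2)
          realign = solve-∀

  cosets : ∀ x y → ∃ λ t → f y ≡ f (t * 2 + x) ⊎ f y ≡ f (t * 2 + (1 + x))
  cosets x y = split (y + x * (4 * m + 1)) (offset y x m)
    where
    offset : ∀ y x m → y + x * (4 * m + 1) + x ≡ y + x * (4 * m + 2)
    offset = solve-∀
    split : ∀ d → d + x ≡ y + x * N → ∃ λ t → f y ≡ f (t * 2 + x) ⊎ f y ≡ f (t * 2 + (1 + x))
    split d e with parity-view d
    ... | even t = t , inj₁ (sym (shifted x e))
    ... | odd t  = t , inj₂ (sym (shifted x (trans (+-suc (t * 2) x) e)))

  small<N : 1 + m * 2 < N
  small<N = ≤-trans (m≤m+n (2 + m * 2) (m * 2)) (≤-reflexive (double m))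
    where double : ∀ m → 2 + m * 2 + m * 2 ≡ 4 * m + 2
          double = solve-∀

  module Anchored (p : ℕ) (fp : f p ≡ N) (q : ℕ) (fq : f q ≡ 1) where

    -- Since N - 1 > 2m, the value 1 lies in the other parity class than N.
    opposite : ∃ λ t₀ → f (t₀ * 2 + (1 + p)) ≡ 1
    opposite with cosets p q
    ... | t , inj₂ e = t , trans (sym e) fq
    ... | t , inj₁ e = ⊥-elim (<⇒≱ small<N (proj₁ (subst₂ (Near (m * 2)) fp (trans (sym e) fq) (coset-near p 0 t))))

    in-class-of-p : ∀ y → 2 + m * 2 ≤ f y → ∃ λ t → f y ≡ f (t * 2 + p)
    in-class-of-p y big with cosets p y | opposite
    ... | t , inj₁ e | _ = t , e
    ... | t , inj₂ e | t₀ , e₀ =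
      ⊥-elim (<⇒≱ big (proj₂ (subst₂ (Near (m * 2)) e₀ (sym e) (coset-near (1 + p) t₀ t))))

    -- Walking k steps of 4 from p: if the value 4k places after p is at most 2m + 3, then k ≥ m ...
    even-offset : ∀ k → f (k * 4 + p) ≤ 3 + m * 2 → m ≤ k
    even-offset k small = s≤s⁻¹ (*-cancelʳ-< 2 m (suc k) (s≤s (+-cancelˡ-≤ (2 + m * 2) (m * 2) (1 + k * 2)
                            (subst₂ _≤_ (split₁ m) (split₂ m k) climb))))
      where
      climb : N ≤ 3 + m * 2 + k * 2
      climb = ≤-trans (subst (_≤ f (k * 4 + p) + k * 2) fp (proj₁ (walk p k))) (+-monoˡ-≤ (k * 2) small)
      split₁ : ∀ m → 4 * m + 2 ≡ 2 + m * 2 + m * 2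
      split₁ = solve-∀
      split₂ : ∀ m k → 3 + m * 2 + k * 2 ≡ 2 + m * 2 + (1 + k * 2)
      split₂ = solve-∀

    -- ... and if the value 4k + 2 places after p is at most 2m + 3 (k < m), then walking the
    -- remaining m - k steps of 4 up to p + N shows k = 0.
    odd-offset : ∀ k o → suc k + o ≡ m → f ((1 + k * 2) * 2 + p) ≤ 3 + m * 2 → k ≡ 0
    odd-offset k o k+1+o≡m small = double≤1 (+-cancelˡ-≤ (6 + k * 2 + o * 4) (k * 2) 1
                                     (subst₂ _≤_ (split₁ k o) (split₂ k o) climb′))
      where
      y : ℕ
      y = (1 + k * 2) * 2 + p
      around : ∀ k o p → suc o * 4 + ((1 + k * 2) * 2 + p) ≡ p + 1 * (4 * (suc k + o) + 2)
      around = solve-∀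
      back : f (suc o * 4 + y) ≡ N
      back = trans (shifted {i = p} 1 (trans (around k o p) (cong (λ m → p + 1 * (4 * m + 2)) k+1+o≡m))) fp
      climb : N ≤ 3 + m * 2 + suc o * 2
      climb = ≤-trans (subst (_≤ f y + suc o * 2) back (proj₂ (walk y (suc o)))) (+-monoˡ-≤ (suc o * 2) small)
      climb′ : 4 * (suc k + o) + 2 ≤ 3 + (suc k + o) * 2 + suc o * 2
      climb′ = subst (λ m → 4 * m + 2 ≤ 3 + m * 2 + suc o * 2) (sym k+1+o≡m) climb
      split₁ : ∀ k o → 4 * (suc k + o) + 2 ≡ 6 + k * 2 + o * 4 + k * 2
      split₁ = solve-∀
      split₂ : ∀ k o → 3 + (suc k + o) * 2 + suc o * 2 ≡ 6 + k * 2 + o * 4 + 1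
      split₂ = solve-∀
      double≤1 : ∀ {k} → k * 2 ≤ 1 → k ≡ 0
      double≤1 {zero} _ = refl
      double≤1 {suc k} (s≤s ())

    pinned : ∀ s → s < M → f (s * 2 + p) ≤ 3 + m * 2 → f (s * 2 + p) ≡ f (m * 4 + p) ⊎ f (s * 2 + p) ≡ f (2 + p)
    pinned s s<M small with parity-view s
    ... | even k = inj₁ (trans (cong f (sym (quadruple k p)))
                               (cong (λ j → f (j * 4 + p)) (≤-antisym (half-≤ {k} {m} s<M) (even-offset k small′))))
      where
      quadruple : ∀ k p → k * 4 + p ≡ k * 2 * 2 + p
      quadruple = solve-∀
      small′ : f (k * 4 + p) ≤ 3 + m * 2
      small′ = subst (_≤ 3 + m * 2) (cong f (sym (quadruple k p))) small
    ... | odd k with m≤n⇒∃[o]m+o≡n (half-< {k} {m} s<M)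
    ...   | o , k+1+o≡m = inj₂ (cong (λ k → f ((1 + k * 2) * 2 + p)) (odd-offset k o k+1+o≡m small))

    low-value-position : ∀ y → 2 + m * 2 ≤ f y → f y ≤ 3 + m * 2 → f y ≡ f (m * 4 + p) ⊎ f y ≡ f (2 + p)
    low-value-position y big small with in-class-of-p y big
    ... | t , e with reduce p t
    ...   | s , s<M , e′ = Sum.map (trans fy≡) (trans fy≡) (pinned s s<M (subst (_≤ 3 + m * 2) fy≡ small))
      where fy≡ : f y ≡ f (s * 2 + p)
            fy≡ = trans e e′

    middle-values : ∀ y₁ y₂ → f y₁ ≡ 2 + m * 2 → f y₂ ≡ 3 + m * 2 → f (m * 4 + p) + f (2 + p) ≡ 5 + m * 4
    middle-values y₁ y₂ e₁ e₂ = begin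
      f (m * 4 + p) + f (2 + p) ≡⟨ pair-sum (low-value-position y₁ (≤-reflexive (sym e₁)) (≤-trans (≤-reflexive e₁) (n≤1+n _)))
                                            (low-value-position y₂ (≤-trans (n≤1+n _) (≤-reflexive (sym e₂))) (≤-reflexive e₂))
                                            (λ e → 1+n≢n (trans (sym e₂) (trans (sym e) e₁))) ⟩
      f y₁ + f y₂               ≡⟨ cong₂ _+_ e₁ e₂ ⟩
      2 + m * 2 + (3 + m * 2)   ≡⟨ add m ⟩
      5 + m * 4                 ∎
      where
      open ≡-Reasoning
      add : ∀ m → 2 + m * 2 + (3 + m * 2) ≡ 5 + m * 4
      add = solve-∀

    -- For m = 2 + n, walking n steps of 4 from positions 8 + p and 10 + p reaches 4m + p and p + N;
    -- together with the telescoped zigzag at p this forces 2N ≤ 2N - 1.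
    impossible : ∀ n → m ≡ 2 + n → ∀ y₁ y₂ → f y₁ ≡ 2 + m * 2 → f y₂ ≡ 3 + m * 2 → ⊥
    impossible n m≡2+n y₁ y₂ e₁ e₂ = <⇒≱ too-small (begin
      N + N                                           ≤⟨ +-mono-≤ (≤-reflexive (sym fp)) from-10 ⟩
      f p + (f (10 + p) + n * 2)                      ≡⟨ +-assoc (f p) (f (10 + p)) (n * 2) ⟨
      f p + f (10 + p) + n * 2                        ≤⟨ +-monoˡ-≤ (n * 2) (zigzag₂ distinct4 p) ⟩
      f (2 + p) + f (8 + p) + 6 + n * 2               ≤⟨ +-monoˡ-≤ (n * 2) (+-monoˡ-≤ 6 (+-monoʳ-≤ (f (2 + p)) to-4m)) ⟩
      f (2 + p) + (f (m * 4 + p) + n * 2) + 6 + n * 2 ≡⟨ regroup (f (2 + p)) (f (m * 4 + p)) n ⟩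
      f (m * 4 + p) + f (2 + p) + 6 + n * 4           ≡⟨ cong (λ s → s + 6 + n * 4) (middle-values y₁ y₂ e₁ e₂) ⟩
      5 + m * 4 + 6 + n * 4                           ∎)
      where
      open ≤-Reasoning
      to-4m : f (8 + p) ≤ f (m * 4 + p) + n * 2
      to-4m = subst (λ j → f (8 + p) ≤ f j + n * 2)
                (trans (eight n p) (cong (λ m → m * 4 + p) (sym m≡2+n))) (proj₁ (walk (8 + p) n))
        where eight : ∀ n p → n * 4 + (8 + p) ≡ (2 + n) * 4 + p
              eight = solve-∀
      from-10 : N ≤ f (10 + p) + n * 2
      from-10 = subst (_≤ f (10 + p) + n * 2) (trans (shifted {i = p} 1 (trans (ten n p) (cong (λ m → p + 1 * (4 * m + 2)) (sym m≡2+n)))) fp)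
                  (proj₂ (walk (10 + p) n))
        where ten : ∀ n p → n * 4 + (10 + p) ≡ p + 1 * (4 * (2 + n) + 2)
              ten = solve-∀
      regroup : ∀ b a n → b + (a + n * 2) + 6 + n * 2 ≡ a + b + 6 + n * 4
      regroup = solve-∀
      too-small : 5 + m * 4 + 6 + n * 4 < N + N
      too-small = subst (λ m → 5 + m * 4 + 6 + n * 4 < 4 * m + 2 + (4 * m + 2)) (sym m≡2+n) (≤-reflexive (count n))
        where count : ∀ n → suc (5 + (2 + n) * 4 + 6 + n * 4) ≡ 4 * (2 + n) + 2 + (4 * (2 + n) + 2)
              count = solve-∀

  not-onto : 2 ≤ m → ¬ (∀ v → v < N → ∃ λ j → f j ≡ suc v)
  not-onto 2≤m onto with m≤n⇒∃[o]m+o≡n 2≤m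
  ... | n , 2+n≡m = Anchored.impossible (proj₁ largest) (trans (proj₂ largest) (sym N≡1+top)) (proj₁ smallest) (proj₂ smallest)
                      n (sym 2+n≡m) (proj₁ lower-middle) (proj₁ upper-middle) (proj₂ lower-middle) (proj₂ upper-middle)
    where
    N≡1+top : N ≡ suc (4 * m + 1)
    N≡1+top = +-suc (4 * m) 1
    largest : ∃ λ j → f j ≡ suc (4 * m + 1)
    largest = onto (4 * m + 1) (≤-reflexive (sym N≡1+top))
    smallest : ∃ λ j → f j ≡ 1
    smallest = onto 0 (≤-trans (s≤s z≤n) small<N)
    lower-middle : ∃ λ j → f j ≡ 2 + m * 2
    lower-middle = onto (1 + m * 2) small<N
    upper-middle : ∃ λ j → f j ≡ 3 + m * 2
    upper-middle = onto (2 + m * 2) (subst (λ m → 2 + m * 2 < 4 * m + 2) 2+n≡m (≤-trans (m≤m+n (7 + n * 2) (3 + n * 2)) (≤-reflexive (split n))))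
      where split : ∀ n → 7 + n * 2 + (3 + n * 2) ≡ 4 * (2 + n) + 2
            split = solve-∀

module _ (m : ℕ) where
  private instance
    N-nonZero : NonZero (4 * m + 2)
    N-nonZero = 4m+2-nonZero m

  -- Otherwise the entries would form a sequence as in Rigid that takes every value 1..N.
  lower-bound : 2 ≤ m → (π : Perm (4 * m + 2)) → 4 ≤ twiceDisc π 4
  lower-bound 2≤m π = ≮⇒≥ λ disc<4 → Rigid.not-onto m f (entry-periodic π) distinct4 (band disc<4) 2≤m (entry-onto π)
    where
    N : ℕ
    N = 4 * m + 2
    f : ℕ → ℕ
    f = entry π
    distinct4 : ∀ i → f (4 + i) ≢ f i
    distinct4 i e = shift-mod 4 i (s≤s z≤n) (≤-trans (m≤m+n 5 5) (+-monoˡ-≤ 2 (*-monoʳ-≤ 4 2≤m))) (entry-injective π e)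
    window-mod : ∀ i → window f i ≡ window f (i % N)
    window-mod i = cong₂ _+_ (cong₂ _+_ (cong₂ _+_ (entry-mod π (mod-absorb 0 i)) (term 1)) (term 2)) (term 3)
      where term : ∀ c → f (c + i) ≡ f (c + i % N)
            term c = entry-mod π (mod-absorb c i)
    band : twiceDisc π 4 < 4 → ∀ i → Near 1 (window f i) (2 * (N + 1))
    band disc<4 i = subst (λ w → Near 1 w (2 * (N + 1))) (sym (window-mod i)) (near-halve near₃)
      where
      r : ℕ
      r = i % N
      dev≤3 : twiceDev π 4 r ≤ 3
      dev≤3 = s≤s⁻¹ (≤-<-trans (max-upper (twiceDev π 4) (∈-upTo⁺ (m%n<n i N))) disc<4)
      near₃ : Near 3 (2 * window f r) (2 * (2 * (N + 1)))
      near₃ = subst₂ (λ w c → Near 3 (2 * w) c) (windowSum≡window π r) (quadruple N)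
                (dist⇒near (2 * windowSum π 4 r) (4 * (N + 1)) dev≤3)
        where quadruple : ∀ N → 4 * (N + 1) ≡ 2 * (2 * (N + 1))
              quadruple = solve-∀

module Construction (m : ℕ) (1≤m : 1 ≤ m) where

  -- Along the cycle a ↦ a + 2 (mod 2m + 1) it visits 0, 2, ..., 2m, 2m - 1, ..., 3, 1:
  -- consecutive values differ by at most 2.
  zig : ℕ → ℕ
  zig a with parity-view a
  ... | even k = k * 2
  ... | odd k  = m * 2 ∸ (1 + k * 2)

  zig-even : ∀ k → zig (k * 2) ≡ k * 2
  zig-even k rewrite parity-view-even k = refl

  zig-odd : ∀ k → zig (1 + k * 2) ≡ m * 2 ∸ (1 + k * 2)
  zig-odd k rewrite parity-view-odd k = refl

  zig-≤ : ∀ a → a ≤ m * 2 → zig a ≤ m * 2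
  zig-≤ a a≤ with parity-view a
  ... | even k = a≤
  ... | odd k  = m∸n≤m (m * 2) (1 + k * 2)

  odd-split : ∀ {k} → 1 + k * 2 ≤ m * 2 → ∃ λ o → m * 2 ≡ (1 + k * 2) + (1 + o * 2)
  odd-split {k} le with m≤n⇒∃[o]m+o≡n (*-cancelʳ-< 2 k m le)
  ... | o , k+1+o≡m = o , trans (cong (_* 2) (sym k+1+o≡m)) (spread k o)
    where spread : ∀ k o → (suc k + o) * 2 ≡ (1 + k * 2) + (1 + o * 2)
          spread = solve-∀

  zig-involutive : ∀ a → a ≤ m * 2 → zig (zig a) ≡ a
  zig-involutive a a≤ with parity-view a
  ... | even k = zig-even k
  ... | odd k with odd-split {k} a≤
  ...   | o , e = begin
    zig (m * 2 ∸ (1 + k * 2))     ≡⟨ cong (λ t → zig (t ∸ (1 + k * 2))) e ⟩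
    zig ((1 + k * 2) + (1 + o * 2) ∸ (1 + k * 2)) ≡⟨ cong zig (m+n∸m≡n (1 + k * 2) (1 + o * 2)) ⟩
    zig (1 + o * 2)               ≡⟨ zig-odd o ⟩
    m * 2 ∸ (1 + o * 2)           ≡⟨ cong (_∸ (1 + o * 2)) e ⟩
    (1 + k * 2) + (1 + o * 2) ∸ (1 + o * 2) ≡⟨ m+n∸n≡m (1 + k * 2) (1 + o * 2) ⟩
    1 + k * 2                     ∎
    where open ≡-Reasoning

  M : ℕ
  M = 1 + m * 2

  1<M : 1 < M
  1<M = s≤s (≤-trans (s≤s z≤n) (*-monoˡ-≤ 2 1≤m))

  zig-step-even : ∀ k → k ≤ m → Near 2 (k * 2) (zig ((2 + k * 2) % M))
  zig-step-even k k≤m with m≤n⇒m<n∨m≡n k≤m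
  ... | inj₁ k<m = subst (Near 2 (k * 2))
                     (sym (trans (cong zig (m<n⇒m%n≡m (s≤s (*-monoˡ-≤ 2 k<m)))) (zig-even (suc k))))
                     (near-+2 (k * 2))
  ... | inj₂ k≡m = subst₂ (Near 2) (sym (cong (_* 2) k≡m)) (sym (trans (cong zig wrap) (zig-odd 0))) (near-∸1 (m * 2))
    where
    wrap : (2 + k * 2) % M ≡ 1
    wrap = trans (cong (λ j → (2 + j * 2) % M) k≡m) (trans ([m+n]%n≡m%n 1 M) (m<n⇒m%n≡m 1<M))

  zig-step-odd : ∀ k → k < m → Near 2 (m * 2 ∸ (1 + k * 2)) (zig ((3 + k * 2) % M))
  zig-step-odd k k<m with m≤n⇒m<n∨m≡n k<m
  ... | inj₁ k+1<m = subst₂ (Near 2) (sym below)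
                       (sym (trans (cong zig (m<n⇒m%n≡m (s≤s (≤-trans (n≤1+n _) 4+2k≤)))) (zig-odd (suc k))))
                       (near-sym (near-+2 (m * 2 ∸ (3 + k * 2))))
    where
    4+2k≤ : 4 + k * 2 ≤ m * 2
    4+2k≤ = *-monoˡ-≤ 2 k+1<m
    shuffle : ∀ k r → (3 + k * 2) + r ≡ (1 + k * 2) + (2 + r)
    shuffle = solve-∀
    below : m * 2 ∸ (1 + k * 2) ≡ 2 + (m * 2 ∸ (3 + k * 2))
    below = begin
      m * 2 ∸ (1 + k * 2)                                     ≡⟨ cong (_∸ (1 + k * 2)) (m+[n∸m]≡n (≤-trans (n≤1+n _) 4+2k≤)) ⟨
      (3 + k * 2) + (m * 2 ∸ (3 + k * 2)) ∸ (1 + k * 2)       ≡⟨ cong (_∸ (1 + k * 2)) (shuffle k (m * 2 ∸ (3 + k * 2))) ⟩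
      (1 + k * 2) + (2 + (m * 2 ∸ (3 + k * 2))) ∸ (1 + k * 2) ≡⟨ m+n∸m≡n (1 + k * 2) _ ⟩
      2 + (m * 2 ∸ (3 + k * 2))                               ∎
      where open ≡-Reasoning
  ... | inj₂ k+1≡m = subst₂ (Near 2) (sym one) (sym (trans (cong zig wrap) (zig-even 0))) (s≤s z≤n , z≤n)
    where
    one : m * 2 ∸ (1 + k * 2) ≡ 1
    one = trans (cong (λ j → j * 2 ∸ (1 + k * 2)) (sym k+1≡m)) (m+n∸n≡m 1 (k * 2))
    wrap : (3 + k * 2) % M ≡ 0
    wrap = trans (cong (λ j → (1 + j * 2) % M) k+1≡m) (n%n≡0 M)

  zig-step : ∀ a → a ≤ m * 2 → Near 2 (zig a) (zig ((2 + a) % M))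
  zig-step a a≤ with parity-view a
  ... | even k = zig-step-even k (*-cancelʳ-≤ k m 2 a≤)
  ... | odd k  = zig-step-odd k (*-cancelʳ-< 2 k m a≤)

  -- The size N of the permutation, its largest value K = N - 1 (values are 0-based here), and the
  -- elementary comparisons between N, K, M and 2m used below.
  N K : ℕ
  N = 4 * m + 2
  K = 4 * m + 1

  N≡1+K : N ≡ suc K
  N≡1+K = +-suc (4 * m) 1

  N≡M*2 : N ≡ M * 2
  N≡M*2 = double m
    where double : ∀ m → 4 * m + 2 ≡ (1 + m * 2) * 2
          double = solve-∀

  K≡M+2m : K ≡ M + m * 2
  K≡M+2m = split m
    where split : ∀ m → 4 * m + 1 ≡ 1 + m * 2 + m * 2
          split = solve-∀

  K<N : K < N
  K<N = ≤-reflexive (sym N≡1+K)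

  2m≤K : m * 2 ≤ K
  2m≤K = ≤-trans (n≤1+n (m * 2)) (≤-trans (m≤m+n M (m * 2)) (≤-reflexive (sym K≡M+2m)))

  2m<N : m * 2 < N
  2m<N = ≤-<-trans 2m≤K K<N

  1+4m<N : 1 + m * 2 * 2 < N
  1+4m<N = ≤-reflexive (sym (full m))
    where full : ∀ m → 4 * m + 2 ≡ 2 + m * 2 * 2
          full = solve-∀

  half-position : ∀ b k → b + k * 2 < N → k ≤ m * 2
  half-position b k lt = s≤s⁻¹ (*-cancelʳ-< 2 k M (≤-<-trans (m≤n+m (k * 2) b) (subst (b + k * 2 <_) N≡M*2 lt)))

  -- The permutation: position 2k (k ≤ 2m) gets value zig k, position 2k + 1 gets K - zig k,
  -- so that each aligned pair of positions carries values summing to K.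
  σ : ℕ → ℕ
  σ i with parity-view i
  ... | even k = zig k
  ... | odd k  = K ∸ zig k

  σ-even : ∀ k → σ (k * 2) ≡ zig k
  σ-even k rewrite parity-view-even k = refl

  σ-odd : ∀ k → σ (1 + k * 2) ≡ K ∸ zig k
  σ-odd k rewrite parity-view-odd k = refl

  τ : ℕ → ℕ
  τ v with v ≤? m * 2
  ... | yes _ = zig v * 2
  ... | no _  = 1 + zig (K ∸ v) * 2

  τ-low : ∀ {v} → v ≤ m * 2 → τ v ≡ zig v * 2
  τ-low {v} v≤ with v ≤? m * 2
  ... | yes _ = refl
  ... | no v≰ = contradiction v≤ v≰

  τ-high : ∀ {v} → ¬ v ≤ m * 2 → τ v ≡ 1 + zig (K ∸ v) * 2
  τ-high {v} v≰ with v ≤? m * 2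
  ... | yes v≤ = contradiction v≤ v≰
  ... | no _   = refl

  complement-large : ∀ {x} → x ≤ m * 2 → ¬ K ∸ x ≤ m * 2
  complement-large {x} x≤ big≤ = <-irrefl refl (≤-trans (≤-trans (≤-reflexive (sym lower)) (∸-monoʳ-≤ K x≤)) big≤)
    where lower : K ∸ m * 2 ≡ M
          lower = trans (cong (_∸ m * 2) K≡M+2m) (m+n∸n≡m M (m * 2))

  complement-small : ∀ {v} → v < N → ¬ v ≤ m * 2 → K ∸ v ≤ m * 2
  complement-small {v} v<N v≰ = ≤-trans (∸-monoʳ-≤ K (≰⇒> v≰)) (≤-reflexive upper)
    where upper : K ∸ M ≡ m * 2
          upper = trans (cong (_∸ M) K≡M+2m) (m+n∸m≡n M (m * 2))

  σ<N : ∀ {i} → i < N → σ i < N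
  σ<N {i} i<N with parity-view i
  ... | even k = ≤-<-trans (zig-≤ k (half-position 0 k i<N)) 2m<N
  ... | odd k  = ≤-<-trans (m∸n≤m K (zig k)) K<N

  τ<N : ∀ {v} → v < N → τ v < N
  τ<N {v} v<N with v ≤? m * 2
  ... | yes v≤ = ≤-<-trans (≤-trans (n≤1+n _) (s≤s (*-monoˡ-≤ 2 (zig-≤ v v≤)))) 1+4m<N
  ... | no v≰  = ≤-<-trans (s≤s (*-monoˡ-≤ 2 (zig-≤ _ (complement-small v<N v≰)))) 1+4m<N

  τσ : ∀ {i} → i < N → τ (σ i) ≡ i
  τσ {i} i<N with parity-view i
  ... | even k = trans (τ-low (zig-≤ k k≤)) (cong (_* 2) (zig-involutive k k≤))
    where k≤ : k ≤ m * 2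
          k≤ = half-position 0 k i<N
  ... | odd k  = trans (τ-high (complement-large (zig-≤ k k≤)))
                   (cong (λ y → 1 + y * 2) (trans (cong zig (m∸[m∸n]≡n (≤-trans (zig-≤ k k≤) 2m≤K))) (zig-involutive k k≤)))
    where k≤ : k ≤ m * 2
          k≤ = half-position 1 k i<N

  στ : ∀ {v} → v < N → σ (τ v) ≡ v
  στ {v} v<N with v ≤? m * 2
  ... | yes v≤ = trans (σ-even (zig v)) (zig-involutive v v≤)
  ... | no v≰  = trans (σ-odd (zig (K ∸ v)))
                   (trans (cong (K ∸_) (zig-involutive _ (complement-small v<N v≰))) (m∸[m∸n]≡n (s≤s⁻¹ (subst (v <_) N≡1+K v<N))))

  private instance
    N-nonZero : NonZero N
    N-nonZero = 4m+2-nonZero m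

  π₀-spec : Σ (Perm N) λ π → ∀ x → toℕ (Inverse.to π x) ≡ σ (toℕ x)
  π₀-spec = perm-from σ τ σ<N τ<N τσ στ

  π₀ : Perm N
  π₀ = proj₁ π₀-spec

  g : ℕ → ℕ
  g = entry π₀

  -- The value at the even position 2k, less one.
  e : ℕ → ℕ
  e k = zig (k % M)

  e≤ : ∀ k → e k ≤ m * 2
  e≤ k = zig-≤ (k % M) (s≤s⁻¹ (m%n<n k M))

  position-mod : ∀ b k → b ≤ 1 → (b + k * 2) % N ≡ b + k % M * 2
  position-mod b k b≤1 = trans (cong (_% N) unfold)
                           (trans ([m+kn]%n≡m%n (b + k % M * 2) (k / M) N) (m<n⇒m%n≡m bound))
    where
    spread : ∀ b r q m → b + (r + q * (1 + m * 2)) * 2 ≡ b + r * 2 + q * (4 * m + 2)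
    spread = solve-∀
    unfold : b + k * 2 ≡ b + k % M * 2 + k / M * N
    unfold = trans (cong (λ t → b + t * 2) (m≡m%n+[m/n]*n k M)) (spread b (k % M) (k / M) m)
    bound : b + k % M * 2 < N
    bound = ≤-<-trans (+-mono-≤ b≤1 (*-monoˡ-≤ 2 (s≤s⁻¹ (m%n<n k M)))) 1+4m<N

  g-even : ∀ k → g (k * 2) ≡ suc (e k)
  g-even k = trans (entry-perm-from π₀ σ (proj₂ π₀-spec) (k * 2))
                   (cong suc (trans (cong σ (position-mod 0 k z≤n)) (σ-even (k % M))))

  g-odd : ∀ k → g (1 + k * 2) ≡ suc (K ∸ e k)
  g-odd k = trans (entry-perm-from π₀ σ (proj₂ π₀-spec) (1 + k * 2))
                  (cong suc (trans (cong σ (position-mod 1 k (s≤s z≤n))) (σ-odd (k % M))))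

  aligned-pair : ∀ k → g (k * 2) + g (1 + k * 2) ≡ N + 1
  aligned-pair k = begin
    g (k * 2) + g (1 + k * 2)     ≡⟨ cong₂ _+_ (g-even k) (g-odd k) ⟩
    suc (e k) + suc (K ∸ e k)     ≡⟨ cong suc (+-suc (e k) (K ∸ e k)) ⟩
    suc (suc (e k + (K ∸ e k)))   ≡⟨ cong (λ t → suc (suc t)) (m+[n∸m]≡n (≤-trans (e≤ k) 2m≤K)) ⟩
    suc (suc K)                   ≡⟨ cong suc N≡1+K ⟨
    suc N                         ≡⟨ +-comm 1 N ⟩
    N + 1                         ∎
    where open ≡-Reasoning

  -- Windows starting at even positions consist of two aligned pairs.
  window-even : ∀ k → window g (k * 2) ≡ (N + 1) + (N + 1)
  window-even k = trans (+-assoc (g (k * 2) + g (1 + k * 2)) _ _) (cong₂ _+_ (aligned-pair k) (aligned-pair (suc k)))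

  window-odd : ∀ k → window g (1 + k * 2) + e k ≡ (N + 1) + (N + 1) + e (2 + k)
  window-odd k = begin
    g (1 + k * 2) + g (2 + k * 2) + g (3 + k * 2) + g (4 + k * 2) + e k
      ≡⟨ regroup (g (1 + k * 2)) (g (2 + k * 2)) (g (3 + k * 2)) (g (4 + k * 2)) (e k) ⟩
    (g (2 + k * 2) + g (3 + k * 2)) + (g (1 + k * 2) + e k) + g (4 + k * 2)
      ≡⟨ cong₃ (aligned-pair (suc k)) first (g-even (2 + k)) ⟩
    (N + 1) + N + suc (e (2 + k))
      ≡⟨ tidy N (e (2 + k)) ⟩
    (N + 1) + (N + 1) + e (2 + k) ∎
    where
    open ≡-Reasoning
    regroup : ∀ b c d x y → b + c + d + x + y ≡ (c + d) + (b + y) + x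
    regroup = solve-∀
    tidy : ∀ N y → N + 1 + N + suc y ≡ N + 1 + (N + 1) + y
    tidy = solve-∀
    first : g (1 + k * 2) + e k ≡ N
    first = trans (cong (_+ e k) (g-odd k)) (trans (cong suc (m∸n+n≡m (≤-trans (e≤ k) 2m≤K))) (sym N≡1+K))
    cong₃ : ∀ {a a′ b b′ c c′ : ℕ} → a ≡ a′ → b ≡ b′ → c ≡ c′ → a + b + c ≡ a′ + b′ + c′
    cong₃ refl refl refl = refl

  e-step : ∀ k → Near 2 (e k) (e (2 + k))
  e-step k = subst (Near 2 (e k)) (cong zig (sym (mod-absorb {M} 2 k))) (zig-step (k % M) (s≤s⁻¹ (m%n<n k M)))

  window-near : ∀ i → Near 2 (window g i) ((N + 1) + (N + 1))
  window-near i with parity-view i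
  ... | even k = subst (λ w → Near 2 w ((N + 1) + (N + 1))) (sym (window-even k)) (near-refl _)
  ... | odd k  = trade (window-odd k) (e-step k)

  upper-bound : twiceDisc π₀ 4 ≤ 4
  upper-bound = max-least (twiceDev π₀ 4) (upTo N) λ {i} _ →
    near⇒dist (2 * windowSum π₀ 4 i) (4 * (N + 1))
      (subst₂ (λ w c → Near 4 (2 * w) c) (sym (windowSum≡window π₀ i)) (quadruple N) (near-double (window-near i)))
    where quadruple : ∀ N → 2 * (N + 1 + (N + 1)) ≡ 4 * (N + 1)
          quadruple = solve-∀

disc-eq : ∀ {n k d} .{{_ : NonZero n}} (π₀ : Perm n) → twiceDisc π₀ k ≤ d → ((π : Perm n) → d ≤ twiceDisc π k) → DiscEq n k d
disc-eq {zero}  _  _  _  = tt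
disc-eq {suc _} π₀ le lb = (π₀ , ≤-antisym le (lb π₀)) , lb

proposition2p2 : (m : ℕ) → 2 ≤ m → DiscEq (4 * m + 2) 4 (2 * 2)
proposition2p2 m 2≤m = disc-eq {{4m+2-nonZero m}} π₀ upper-bound (lower-bound m 2≤m)
  where open Construction m (≤-trans (s≤s z≤n) 2≤m)
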